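{- For every Johnson graph $J(m,k)$ (with $m,k\in\mathbb{N}$, $k\le m$), the VC-dimension of the edge relation on $J(m,k)$ is at most $4$.
   Context: For $m\ge k$ and a set $X$ with $|X|=m$, the Johnson graph $J(m,k)$ has vertex set $\binom{X}{k}$ (all $k$-element subsets of $X$), two vertices being adjacent iff their intersection has size $k-1$ (equivalently, their symmetric difference has size $2$). For a graph $G$ and vertex $v$, $N(v)$ denotes the open neighbourhood of $v$ (so $v\notin N(v)$). The set system of the edge relation on $G$ is $(V(G),\mathcal{S}_E)$ with $\mathcal{S}_E=\{N(v): v\in V(G)\}$. A set $A\subseteq V(G)$ is shattered if $\{A\cap S: S\in\mathcal{S}_E\}$ is the full power set of $A$; the VC-dimension of the edge relation on $G$ is the supremum of the sizes of shattered sets. -}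

module Defs where

open import Data.Nat using (ℕ; _+_; _≤_)
open import Data.Fin using (Fin)
open import Data.Fin.Subset using (Subset; _∩_; ∣_∣; _∈_)
open import Data.Product using (Σ; ∃; proj₁)
open import Relation.Binary.PropositionalEquality using (_≡_)
open import Function.Bundles using (_⇔_)
open import Function.Definitions using (Injective)

JVertex : ℕ → ℕ → Set
JVertex m k = Σ (Subset m) (λ s → ∣ s ∣ ≡ k)

-- Adjacency in J(m,k): |u ∩ v| = k - 1, written without truncated
-- subtraction as |u ∩ v| + 1 = k (so no loops, also when k = 0).
JAdj : {m k : ℕ} → JVertex m k → JVertex m k → Set
JAdj {m} {k} u v = ∣ proj₁ u ∩ proj₁ v ∣ + 1 ≡ k

_∈N_ : {m k : ℕ} → JVertex m k → JVertex m k → Set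
a ∈N v = JAdj v a

Shattered : {m k n : ℕ} → (Fin n → JVertex m k) → Set
Shattered {m} {k} {n} A =
  (B : Subset n) → ∃ λ (v : JVertex m k) → (i : Fin n) → (i ∈ B) ⇔ (A i ∈N v)

Distinct : {m k n : ℕ} → (Fin n → JVertex m k) → Set
Distinct A = Injective _≡_ _≡_ (λ i → proj₁ (A i))

VCdimEdge≤ : ℕ → ℕ → ℕ → Set
VCdimEdge≤ m k d =
  (n : ℕ) (A : Fin n → JVertex m k) → Distinct A → Shattered A → n ≤ d

-- Shattering the full set yields a vertex v adjacent to every listed vertex a_i, so each
-- a_i is v with one point x_i swapped out for a point y_i.  A vertex u is then adjacent to
-- a_i iff [x_i ∈ v ─ u] + [y_i ∈ u ─ v] = |v ─ u|, where |v ─ u| = |u ─ v|; so shattering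
-- by neighbourhoods becomes shattering the swaps (x_i, y_i) by pairs (L, R) of subsets of
-- equal size, and shattering forces the swaps to be distinct.
-- If two swaps i, j differ in both coordinates, the pair (L, R) realizing any set that
-- contains i and j but misses something is one of three explicit pairs, whereas four such
-- sets are needed once there are five swaps; hence any two swaps share a coordinate.
-- Distinct swaps meeting pairwise form a star, say all x_i are equal, and then no pair
-- (L, R) separates {0, 1, 2} from {3, 4}.
module Submission where

open import Defs
open import Data.Bool using (true; false; _∧_; not; if_then_else_)
open import Data.Empty using (⊥; ⊥-elim)
open import Data.Fin using (Fin; zero; suc; punchIn; punchOut; _↑ˡ_)
open import Data.Fin.Patterns using (0F; 1F; 2F)
open import Data.Fin.Properties
  using (_≟_; pigeonhole; <⇒≢; suc-injective; punchInᵢ≢i; punchIn-injective; punchIn-punchOut;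
         ↑ˡ-injective)
open import Data.Fin.Subset using (Subset; ⊤; ⁅_⁆; _∩_; _∪_; _─_; _-_; ∣_∣; _∈_; _∉_; _⊆_)
  renaming (⊥ to ∅)
open import Data.Fin.Subset.Properties
  using (_∈?_; ∈⊤; ∉⊥; drop-there; nonempty?; Empty-unique; ∣⊥∣≡0; ∩-comm; ∩-zeroʳ; x∈⁅x⁆; x∈⁅y⁆⇒x≡y;
         x≢y⇒x∉⁅y⁆; q⊆p∪q; x∈p∪q⁺; x∈p∪q⁻; ⊆-antisym; p─q⊆p; x∈p∧x≢y⇒x∈p-y; x∈p⇒∣p-x∣<∣p∣)
open import Data.Nat using (ℕ; suc; _+_; _≤_; _<_; _≤?_; z≤n; s≤s)
open import Data.Nat.Properties
  using (+-0-commutativeMonoid; +-comm; +-assoc; +-suc; +-monoˡ-≤; +-cancelˡ-≡; ≤-trans; n<1+n; 1+n≰n;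
         0≢1+n; ≰⇒>; m≤n⇒∃[o]m+o≡n)
open import Algebra.Properties.CommutativeMonoid.Sum +-0-commutativeMonoid
  using (sum; sum-cong-≗; ∑-distrib-+)
open import Data.Product using (∃; ∃₂; _×_; _,_; proj₁; proj₂; uncurry)
open import Data.Sum as Sum using (_⊎_; inj₁; inj₂; [_,_]′)
open import Data.Vec using ([]; _∷_; lookup; here; there)
open import Data.Vec.Properties using (lookup-zipWith; []=⇒lookup; lookup⇒[]=)
open import Function using (_∘_; id; flip; _⇔_; mk⇔; Equivalence)
open import Function.Construct.Composition using (_⇔-∘_)
open import Function.Definitions using (Injective)
open import Relation.Binary.Definitions using (DecidableEquality)
open import Relation.Binary.PropositionalEquality
  using (_≡_; _≢_; refl; sym; trans; cong; cong₂; subst; subst₂; module ≡-Reasoning)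
open import Relation.Nullary using (¬_; yes; no)

χ : ∀ {n} → Subset n → Fin n → ℕ
χ p z = if lookup p z then 1 else 0

∈⇒χ≡1 : ∀ {n} {p : Subset n} {z} → z ∈ p → χ p z ≡ 1
∈⇒χ≡1 z∈p rewrite []=⇒lookup z∈p = refl

∉⇒χ≡0 : ∀ {n} {p : Subset n} {z} → z ∉ p → χ p z ≡ 0
∉⇒χ≡0 {p = p} {z} z∉p with lookup p z in pz
... | true  = ⊥-elim (z∉p (lookup⇒[]= z p pz))
... | false = refl

χ≡1⇒∈ : ∀ {n} {p : Subset n} {z} → χ p z ≡ 1 → z ∈ p
χ≡1⇒∈ {p = p} {z} _ with lookup p z in pz
... | true  = lookup⇒[]= z p pz
χ≡1⇒∈ () | false

χ+χ≡2⇒∈×∈ : ∀ {n} {p q : Subset n} {a b} → χ p a + χ q b ≡ 2 → a ∈ p × b ∈ q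
χ+χ≡2⇒∈×∈ {p = p} {q} {a} {b} _ with lookup p a in pa | lookup q b in qb
... | true  | true  = lookup⇒[]= a p pa , lookup⇒[]= b q qb
χ+χ≡2⇒∈×∈ () | true  | false
χ+χ≡2⇒∈×∈ () | false | true
χ+χ≡2⇒∈×∈ () | false | false

χ≤1 : ∀ {n} (p : Subset n) z → χ p z ≤ 1
χ≤1 p z with lookup p z
... | true  = s≤s z≤n
... | false = z≤n

lookup-∩ : ∀ {n} (p q : Subset n) z → lookup (p ∩ q) z ≡ lookup p z ∧ lookup q z
lookup-∩ p q z = lookup-zipWith _∧_ z p q

lookup-─ : ∀ {n} (p q : Subset n) z → lookup (p ─ q) z ≡ lookup p z ∧ not (lookup q z)
lookup-─ (true  ∷ p) (true  ∷ q) zero    = refl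
lookup-─ (true  ∷ p) (false ∷ q) zero    = refl
lookup-─ (false ∷ p) (true  ∷ q) zero    = refl
lookup-─ (false ∷ p) (false ∷ q) zero    = refl
lookup-─ (_     ∷ p) (_     ∷ q) (suc z) = lookup-─ p q z

χ-─-∈ : ∀ {n} (p : Subset n) {q x} → x ∈ q → χ (q ─ p) x + χ p x ≡ 1
χ-─-∈ p {q} {x} x∈q rewrite lookup-─ q p x | []=⇒lookup x∈q with lookup p x
... | true  = refl
... | false = refl

χ-─-∉ : ∀ {n} (p : Subset n) {q x} → x ∉ q → χ (p ─ q) x ≡ χ p x
χ-─-∉ p {q} {x} x∉q rewrite lookup-─ p q x with lookup q x in qx
... | true  = ⊥-elim (x∉q (lookup⇒[]= x q qx))
... | false with lookup p x
...   | true  = refl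
...   | false = refl

∣p∣≡∑χ : ∀ {n} (p : Subset n) → ∣ p ∣ ≡ sum (χ p)
∣p∣≡∑χ []          = refl
∣p∣≡∑χ (true  ∷ p) = cong suc (∣p∣≡∑χ p)
∣p∣≡∑χ (false ∷ p) = ∣p∣≡∑χ p

∣∣-+-cong : ∀ {n} {p q r s : Subset n} → (∀ z → χ p z + χ q z ≡ χ r z + χ s z) →
            ∣ p ∣ + ∣ q ∣ ≡ ∣ r ∣ + ∣ s ∣
∣∣-+-cong {p = p} {q} {r} {s} pointwise = begin
  ∣ p ∣ + ∣ q ∣               ≡⟨ cong₂ _+_ (∣p∣≡∑χ p) (∣p∣≡∑χ q) ⟩
  sum (χ p) + sum (χ q)       ≡⟨ ∑-distrib-+ (χ p) (χ q) ⟨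
  sum (λ z → χ p z + χ q z)   ≡⟨ sum-cong-≗ pointwise ⟩
  sum (λ z → χ r z + χ s z)   ≡⟨ ∑-distrib-+ (χ r) (χ s) ⟩
  sum (χ r) + sum (χ s)       ≡⟨ cong₂ _+_ (∣p∣≡∑χ r) (∣p∣≡∑χ s) ⟨
  ∣ r ∣ + ∣ s ∣               ∎
  where open ≡-Reasoning

∣p∣≡∣p∩q∣+∣p─q∣ : ∀ {n} (p q : Subset n) → ∣ p ∣ ≡ ∣ p ∩ q ∣ + ∣ p ─ q ∣
∣p∣≡∣p∩q∣+∣p─q∣ []          []          = refl
∣p∣≡∣p∩q∣+∣p─q∣ (true  ∷ p) (true  ∷ q) = cong suc (∣p∣≡∣p∩q∣+∣p─q∣ p q)
∣p∣≡∣p∩q∣+∣p─q∣ (true  ∷ p) (false ∷ q) = trans (cong suc (∣p∣≡∣p∩q∣+∣p─q∣ p q)) (sym (+-suc _ _))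
∣p∣≡∣p∩q∣+∣p─q∣ (false ∷ p) (true  ∷ q) = ∣p∣≡∣p∩q∣+∣p─q∣ p q
∣p∣≡∣p∩q∣+∣p─q∣ (false ∷ p) (false ∷ q) = ∣p∣≡∣p∩q∣+∣p─q∣ p q

∣p∣≡∣q∣⇒∣p─q∣≡∣q─p∣ : ∀ {n} {p q : Subset n} → ∣ p ∣ ≡ ∣ q ∣ → ∣ p ─ q ∣ ≡ ∣ q ─ p ∣
∣p∣≡∣q∣⇒∣p─q∣≡∣q─p∣ {p = p} {q} ∣p∣≡∣q∣ = +-cancelˡ-≡ ∣ p ∩ q ∣ _ _ (begin
  ∣ p ∩ q ∣ + ∣ p ─ q ∣   ≡⟨ ∣p∣≡∣p∩q∣+∣p─q∣ p q ⟨
  ∣ p ∣                   ≡⟨ ∣p∣≡∣q∣ ⟩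
  ∣ q ∣                   ≡⟨ ∣p∣≡∣p∩q∣+∣p─q∣ q p ⟩
  ∣ q ∩ p ∣ + ∣ q ─ p ∣   ≡⟨ cong (λ s → ∣ s ∣ + ∣ q ─ p ∣) (∩-comm q p) ⟩
  ∣ p ∩ q ∣ + ∣ q ─ p ∣   ∎)
  where open ≡-Reasoning

∣u∩a∣+∣u∩v─a∣≡∣u∩v∣+∣u∩a─v∣ : ∀ {n} (u a v : Subset n) →
                              ∣ u ∩ a ∣ + ∣ u ∩ (v ─ a) ∣ ≡ ∣ u ∩ v ∣ + ∣ u ∩ (a ─ v) ∣
∣u∩a∣+∣u∩v─a∣≡∣u∩v∣+∣u∩a─v∣ u a v = ∣∣-+-cong {p = u ∩ a} {u ∩ (v ─ a)} {u ∩ v} {u ∩ (a ─ v)} pointwise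
  where
  pointwise : ∀ z → χ (u ∩ a) z + χ (u ∩ (v ─ a)) z ≡ χ (u ∩ v) z + χ (u ∩ (a ─ v)) z
  pointwise z
    rewrite lookup-∩ u a z | lookup-∩ u (v ─ a) z | lookup-∩ u v z | lookup-∩ u (a ─ v) z
          | lookup-─ v a z | lookup-─ a v z
    with lookup u z | lookup a z | lookup v z
  ... | false | _     | _     = refl
  ... | true  | true  | true  = refl
  ... | true  | true  | false = refl
  ... | true  | false | true  = refl
  ... | true  | false | false = refl

∣p∩⁅x⁆∣≡χ : ∀ {n} (p : Subset n) x → ∣ p ∩ ⁅ x ⁆ ∣ ≡ χ p x
∣p∩⁅x⁆∣≡χ {suc n} (true  ∷ p) zero    = cong suc (trans (cong ∣_∣ (∩-zeroʳ p)) (∣⊥∣≡0 n))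
∣p∩⁅x⁆∣≡χ {suc n} (false ∷ p) zero    = trans (cong ∣_∣ (∩-zeroʳ p)) (∣⊥∣≡0 n)
∣p∩⁅x⁆∣≡χ         (true  ∷ p) (suc x) = ∣p∩⁅x⁆∣≡χ p x
∣p∩⁅x⁆∣≡χ         (false ∷ p) (suc x) = ∣p∩⁅x⁆∣≡χ p x

k≤∣p-x∣⇒k<∣p∣ : ∀ {n} {p : Subset n} {x k} → x ∈ p → k ≤ ∣ p - x ∣ → k < ∣ p ∣
k≤∣p-x∣⇒k<∣p∣ x∈p k≤∣p-x∣ = ≤-trans (s≤s k≤∣p-x∣) (x∈p⇒∣p-x∣<∣p∣ x∈p)

x∈p⇒0<∣p∣ : ∀ {n} {p : Subset n} {x} → x ∈ p → 0 < ∣ p ∣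
x∈p⇒0<∣p∣ x∈p = k≤∣p-x∣⇒k<∣p∣ x∈p z≤n

distinct-∈⇒2≤∣p∣ : ∀ {n} {p : Subset n} {x y} → x ∈ p → y ∈ p → x ≢ y → 2 ≤ ∣ p ∣
distinct-∈⇒2≤∣p∣ x∈p y∈p x≢y =
  k≤∣p-x∣⇒k<∣p∣ x∈p (x∈p⇒0<∣p∣ (x∈p∧x≢y⇒x∈p-y y∈p (x≢y ∘ sym)))

distinct-∈⇒3≤∣p∣ : ∀ {n} {p : Subset n} {x y z} → x ∈ p → y ∈ p → z ∈ p →
                   x ≢ y → x ≢ z → y ≢ z → 3 ≤ ∣ p ∣
distinct-∈⇒3≤∣p∣ x∈p y∈p z∈p x≢y x≢z y≢z =
  k≤∣p-x∣⇒k<∣p∣ x∈p (distinct-∈⇒2≤∣p∣ (x∈p∧x≢y⇒x∈p-y y∈p (x≢y ∘ sym))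
                                     (x∈p∧x≢y⇒x∈p-y z∈p (x≢z ∘ sym)) y≢z)

∣p∣≡0⇒χ≡0 : ∀ {n} {p : Subset n} z → ∣ p ∣ ≡ 0 → χ p z ≡ 0
∣p∣≡0⇒χ≡0 {p = p} _ ∣p∣≡0 = ∉⇒χ≡0 {p = p} (λ z∈p → 1+n≰n (subst (1 ≤_) ∣p∣≡0 (x∈p⇒0<∣p∣ z∈p)))

∣p∣≡1⇒∈-unique : ∀ {n} {p : Subset n} {x y} → ∣ p ∣ ≡ 1 → x ∈ p → y ∈ p → y ≡ x
∣p∣≡1⇒∈-unique {x = x} {y} ∣p∣≡1 x∈p y∈p with y ≟ x
... | yes y≡x = y≡x
... | no  y≢x = ⊥-elim (1+n≰n (subst (2 ≤_) ∣p∣≡1 (distinct-∈⇒2≤∣p∣ x∈p y∈p (y≢x ∘ sym))))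

∣p∣≡2⇒∈-pair : ∀ {n} {p : Subset n} {x y z} → ∣ p ∣ ≡ 2 → x ∈ p → y ∈ p → x ≢ y → z ∈ p →
               z ≡ x ⊎ z ≡ y
∣p∣≡2⇒∈-pair {x = x} {y} {z} ∣p∣≡2 x∈p y∈p x≢y z∈p with z ≟ x | z ≟ y
... | yes z≡x | _       = inj₁ z≡x
... | no  _   | yes z≡y = inj₂ z≡y
... | no  z≢x | no  z≢y =
  ⊥-elim (1+n≰n (subst (3 ≤_) ∣p∣≡2 (distinct-∈⇒3≤∣p∣ x∈p y∈p z∈p x≢y (z≢x ∘ sym) (z≢y ∘ sym))))

∣p∣≡1⇒p≡⁅x⁆ : ∀ {n} {p : Subset n} {x} → ∣ p ∣ ≡ 1 → x ∈ p → p ≡ ⁅ x ⁆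
∣p∣≡1⇒p≡⁅x⁆ {x = x} ∣p∣≡1 x∈p = ⊆-antisym
  (λ z∈p → subst (_∈ ⁅ x ⁆) (sym (∣p∣≡1⇒∈-unique ∣p∣≡1 x∈p z∈p)) (x∈⁅x⁆ x))
  (λ z∈⁅x⁆ → subst (_∈ _) (sym (x∈⁅y⁆⇒x≡y x z∈⁅x⁆)) x∈p)

∣p∣≡1⇒∃[x]p≡⁅x⁆ : ∀ {n} {p : Subset n} → ∣ p ∣ ≡ 1 → ∃ λ x → p ≡ ⁅ x ⁆
∣p∣≡1⇒∃[x]p≡⁅x⁆ {n} {p} ∣p∣≡1 with nonempty? p
... | yes (x , x∈p) = x , ∣p∣≡1⇒p≡⁅x⁆ ∣p∣≡1 x∈p
... | no  p-empty   =
  ⊥-elim (0≢1+n (trans (sym (∣⊥∣≡0 n)) (trans (cong ∣_∣ (sym (Empty-unique p-empty))) ∣p∣≡1)))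

∣p∣≡2⇒p≡⁅x⁆∪⁅y⁆ : ∀ {n} {p : Subset n} {x y} → ∣ p ∣ ≡ 2 → x ∈ p → y ∈ p → x ≢ y →
                   p ≡ ⁅ x ⁆ ∪ ⁅ y ⁆
∣p∣≡2⇒p≡⁅x⁆∪⁅y⁆ {x = x} {y} ∣p∣≡2 x∈p y∈p x≢y = ⊆-antisym
  (λ z∈p → x∈p∪q⁺ (Sum.map (λ z≡x → subst (_∈ ⁅ x ⁆) (sym z≡x) (x∈⁅x⁆ x))
                           (λ z≡y → subst (_∈ ⁅ y ⁆) (sym z≡y) (x∈⁅x⁆ y))
                           (∣p∣≡2⇒∈-pair ∣p∣≡2 x∈p y∈p x≢y z∈p)))
  (λ z∈⁅x⁆∪⁅y⁆ → [ (λ z∈⁅x⁆ → subst (_∈ _) (sym (x∈⁅y⁆⇒x≡y x z∈⁅x⁆)) x∈p)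
                 , (λ z∈⁅y⁆ → subst (_∈ _) (sym (x∈⁅y⁆⇒x≡y y z∈⁅y⁆)) y∈p)
                 ]′ (x∈p∪q⁻ _ _ z∈⁅x⁆∪⁅y⁆))

x∈p─q⇒x∉q : ∀ {n} (p q : Subset n) {x} → x ∈ p ─ q → x ∉ q
x∈p─q⇒x∉q (_ ∷ p) (_    ∷ q) (there x∈p─q) (there x∈q) = x∈p─q⇒x∉q p q x∈p─q x∈q
x∈p─q⇒x∉q (_ ∷ p) (true ∷ q) ()            here

x∉⁅y⁆∪q : ∀ {n} {q : Subset n} {x y} → x ≢ y → x ∉ q → x ∉ ⁅ y ⁆ ∪ q
x∉⁅y⁆∪q x≢y x∉q x∈⁅y⁆∪q = [ x≢y ∘ x∈⁅y⁆⇒x≡y _ , x∉q ]′ (x∈p∪q⁻ _ _ x∈⁅y⁆∪q)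

-- Neighbours of a common vertex

adjacent⇒swap : ∀ {n k} {v a : Subset n} → ∣ v ∣ ≡ k → ∣ a ∣ ≡ k → ∣ v ∩ a ∣ + 1 ≡ k →
                ∃₂ λ x y → v ─ a ≡ ⁅ x ⁆ × a ─ v ≡ ⁅ y ⁆
adjacent⇒swap {v = v} {a} ∣v∣≡k ∣a∣≡k adjacent =
  let x , v─a≡⁅x⁆ = ∣p∣≡1⇒∃[x]p≡⁅x⁆ ∣v─a∣≡1
      y , a─v≡⁅y⁆ = ∣p∣≡1⇒∃[x]p≡⁅x⁆ (trans (sym (∣p∣≡∣q∣⇒∣p─q∣≡∣q─p∣ {p = v} ∣v∣≡∣a∣)) ∣v─a∣≡1)
  in x , y , v─a≡⁅x⁆ , a─v≡⁅y⁆
  where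
  ∣v∣≡∣a∣ : ∣ v ∣ ≡ ∣ a ∣
  ∣v∣≡∣a∣ = trans ∣v∣≡k (sym ∣a∣≡k)
  ∣v─a∣≡1 : ∣ v ─ a ∣ ≡ 1
  ∣v─a∣≡1 = +-cancelˡ-≡ ∣ v ∩ a ∣ _ _ (trans (sym (∣p∣≡∣p∩q∣+∣p─q∣ v a)) (trans ∣v∣≡k (sym adjacent)))

module _ {n} {v a : Subset n} {x y} (v─a≡⁅x⁆ : v ─ a ≡ ⁅ x ⁆) (a─v≡⁅y⁆ : a ─ v ≡ ⁅ y ⁆) where

  swap-overlap : ∀ u → ∣ u ∩ a ∣ + χ u x ≡ ∣ u ∩ v ∣ + χ u y
  swap-overlap u = begin
    ∣ u ∩ a ∣ + χ u x               ≡⟨ cong (∣ u ∩ a ∣ +_) (∣p∩⁅x⁆∣≡χ u x) ⟨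
    ∣ u ∩ a ∣ + ∣ u ∩ ⁅ x ⁆ ∣       ≡⟨ cong (λ s → ∣ u ∩ a ∣ + ∣ u ∩ s ∣) v─a≡⁅x⁆ ⟨
    ∣ u ∩ a ∣ + ∣ u ∩ (v ─ a) ∣     ≡⟨ ∣u∩a∣+∣u∩v─a∣≡∣u∩v∣+∣u∩a─v∣ u a v ⟩
    ∣ u ∩ v ∣ + ∣ u ∩ (a ─ v) ∣     ≡⟨ cong (λ s → ∣ u ∩ v ∣ + ∣ u ∩ s ∣) a─v≡⁅y⁆ ⟩
    ∣ u ∩ v ∣ + ∣ u ∩ ⁅ y ⁆ ∣       ≡⟨ cong (∣ u ∩ v ∣ +_) (∣p∩⁅x⁆∣≡χ u y) ⟩
    ∣ u ∩ v ∣ + χ u y               ∎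
    where open ≡-Reasoning

  adjacent⇔swap-hit : ∀ {k} → ∣ v ∣ ≡ k → (u : Subset n) →
                      (∣ u ∩ a ∣ + 1 ≡ k) ⇔ (χ (v ─ u) x + χ (u ─ v) y ≡ ∣ v ─ u ∣)
  adjacent⇔swap-hit {k} ∣v∣≡k u =
    mk⇔ (λ adjacent → +-cancelˡ-≡ t _ _ (trans (sym ∣u∩a∣+1≡t+hits) (trans adjacent k≡t+∣v─u∣)))
        (λ hit → trans ∣u∩a∣+1≡t+hits (trans (cong (t +_) hit) (sym k≡t+∣v─u∣)))
    where
    open ≡-Reasoning
    t : ℕ
    t = ∣ u ∩ v ∣
    x∈v : x ∈ v
    x∈v = p─q⊆p v a (subst (x ∈_) (sym v─a≡⁅x⁆) (x∈⁅x⁆ x))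
    y∉v : y ∉ v
    y∉v = x∈p─q⇒x∉q a v (subst (y ∈_) (sym a─v≡⁅y⁆) (x∈⁅x⁆ y))
    k≡t+∣v─u∣ : k ≡ t + ∣ v ─ u ∣
    k≡t+∣v─u∣ = trans (sym ∣v∣≡k)
                      (trans (∣p∣≡∣p∩q∣+∣p─q∣ v u) (cong (λ s → ∣ s ∣ + ∣ v ─ u ∣) (∩-comm v u)))
    ∣u∩a∣+1≡t+hits : ∣ u ∩ a ∣ + 1 ≡ t + (χ (v ─ u) x + χ (u ─ v) y)
    ∣u∩a∣+1≡t+hits = begin
      ∣ u ∩ a ∣ + 1                       ≡⟨ cong (∣ u ∩ a ∣ +_) (χ-─-∈ u x∈v) ⟨
      ∣ u ∩ a ∣ + (χ (v ─ u) x + χ u x)   ≡⟨ cong (∣ u ∩ a ∣ +_) (+-comm _ (χ u x)) ⟩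
      ∣ u ∩ a ∣ + (χ u x + χ (v ─ u) x)   ≡⟨ +-assoc ∣ u ∩ a ∣ (χ u x) (χ (v ─ u) x) ⟨
      ∣ u ∩ a ∣ + χ u x + χ (v ─ u) x     ≡⟨ cong (_+ χ (v ─ u) x) (swap-overlap u) ⟩
      t + χ u y + χ (v ─ u) x             ≡⟨ +-assoc t (χ u y) _ ⟩
      t + (χ u y + χ (v ─ u) x)           ≡⟨ cong (t +_) (+-comm (χ u y) _) ⟩
      t + (χ (v ─ u) x + χ u y)           ≡⟨ cong (λ c → t + (χ (v ─ u) x + c)) (χ-─-∉ u y∉v) ⟨
      t + (χ (v ─ u) x + χ (u ─ v) y)     ∎

-- Shattering swaps

Hits : ∀ {n m} → (Fin n → Fin m) → (Fin n → Fin m) → Subset m → Subset m → Fin n → Set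
Hits x y L R i = χ L (x i) + χ R (y i) ≡ ∣ L ∣

record Realizer {n m} (x y : Fin n → Fin m) (B : Subset n) : Set where
  field
    L R      : Subset m
    balanced : ∣ L ∣ ≡ ∣ R ∣
    realizes : ∀ i → i ∈ B ⇔ Hits x y L R i

SwapsShattered : ∀ {n m} → (Fin n → Fin m) → (Fin n → Fin m) → Set
SwapsShattered x y = ∀ B → Realizer x y B

shattered⇒swaps-shattered : ∀ {n m k} {A : Fin n → JVertex m k} → Shattered A →
                            ∃₂ λ (x y : Fin n → Fin m) → SwapsShattered x y
shattered⇒swaps-shattered {n} {m} {k} {A} shattered = x , y , realizer
  where
  v : Subset m
  v = proj₁ (proj₁ (shattered ⊤))
  ∣v∣≡k : ∣ v ∣ ≡ k
  ∣v∣≡k = proj₂ (proj₁ (shattered ⊤))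
  swap : ∀ i → ∃₂ λ x y → v ─ proj₁ (A i) ≡ ⁅ x ⁆ × proj₁ (A i) ─ v ≡ ⁅ y ⁆
  swap i = adjacent⇒swap ∣v∣≡k (proj₂ (A i)) (Equivalence.to (proj₂ (shattered ⊤) i) ∈⊤)
  x y : Fin n → Fin m
  x i = proj₁ (swap i)
  y i = proj₁ (proj₂ (swap i))
  realizer : SwapsShattered x y
  realizer B = record
    { L        = v ─ u
    ; R        = u ─ v
    ; balanced = ∣p∣≡∣q∣⇒∣p─q∣≡∣q─p∣ {p = v} (trans ∣v∣≡k (sym (proj₂ (proj₁ (shattered B)))))
    ; realizes = λ i → let _ , _ , v─a≡⁅x⁆ , a─v≡⁅y⁆ = swap i in
                       adjacent⇔swap-hit v─a≡⁅x⁆ a─v≡⁅y⁆ ∣v∣≡k u ⇔-∘ proj₂ (shattered B) i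
    }
    where
    u : Subset m
    u = proj₁ (proj₁ (shattered B))

module _ {n m} {x y : Fin n → Fin m} where

  flip-realizer : ∀ {B} → Realizer x y B → Realizer y x B
  flip-realizer r = record
    { L        = R
    ; R        = L
    ; balanced = sym balanced
    ; realizes = λ i → mk⇔ (λ hit → trans (+-comm (χ R (y i)) (χ L (x i))) (trans hit balanced))
                           (λ hit → trans (+-comm (χ L (x i)) (χ R (y i))) (trans hit (sym balanced)))
                       ⇔-∘ realizes i
    }
    where open Realizer r

  flip-shattered : SwapsShattered x y → SwapsShattered y x
  flip-shattered sh = flip-realizer ∘ sh

  shattered⇒swaps-injective : SwapsShattered x y → ∀ {i j} → x i ≡ x j → y i ≡ y j → i ≡ j
  shattered⇒swaps-injective sh {i} {j} xi≡xj yi≡yj =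
    sym (x∈⁅y⁆⇒x≡y i (Equivalence.from (realizes j)
      (subst₂ (λ a b → χ L a + χ R b ≡ ∣ L ∣) xi≡xj yi≡yj (Equivalence.to (realizes i) (x∈⁅x⁆ i)))))
    where open Realizer (sh ⁅ i ⁆)

  same-split⇒⊆ : ∀ {B B'} (r : Realizer x y B) (r' : Realizer x y B') →
                 Realizer.L r ≡ Realizer.L r' → Realizer.R r ≡ Realizer.R r' → B ⊆ B'
  same-split⇒⊆ r r' L≡L' R≡R' {i} i∈B = Equivalence.from (Realizer.realizes r' i)
    (subst₂ (λ L R → Hits x y L R i) L≡L' R≡R' (Equivalence.to (Realizer.realizes r i) i∈B))

  module _ {B i j} (r : Realizer x y B) (i∈B : i ∈ B) (j∈B : j ∈ B) where
    open Realizer r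

    private
      hits-i : Hits x y L R i
      hits-i = Equivalence.to (realizes i) i∈B

      hits-j : Hits x y L R j
      hits-j = Equivalence.to (realizes j) j∈B

    single-shape : x i ≢ x j → x i ∈ L → y i ∉ R → L ≡ ⁅ x i ⁆ × R ≡ ⁅ y j ⁆
    single-shape xi≢xj xi∈L yi∉R = ∣p∣≡1⇒p≡⁅x⁆ ∣L∣≡1 xi∈L , ∣p∣≡1⇒p≡⁅x⁆ (trans (sym balanced) ∣L∣≡1) yj∈R
      where
      ∣L∣≡1 : ∣ L ∣ ≡ 1
      ∣L∣≡1 = trans (sym hits-i) (cong₂ _+_ (∈⇒χ≡1 xi∈L) (∉⇒χ≡0 yi∉R))
      xj∉L : x j ∉ L
      xj∉L xj∈L = xi≢xj (sym (∣p∣≡1⇒∈-unique ∣L∣≡1 xi∈L xj∈L))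
      yj∈R : y j ∈ R
      yj∈R = χ≡1⇒∈ (trans (sym (cong (_+ χ R (y j)) (∉⇒χ≡0 xj∉L))) (trans hits-j ∣L∣≡1))

    double-shape : x i ≢ x j → y i ≢ y j → x i ∈ L → y i ∈ R →
                   L ≡ ⁅ x i ⁆ ∪ ⁅ x j ⁆ × R ≡ ⁅ y i ⁆ ∪ ⁅ y j ⁆
    double-shape xi≢xj yi≢yj xi∈L yi∈R =
      let xj∈L , yj∈R = χ+χ≡2⇒∈×∈ (trans hits-j ∣L∣≡2) in
      ∣p∣≡2⇒p≡⁅x⁆∪⁅y⁆ ∣L∣≡2 xi∈L xj∈L xi≢xj ,
      ∣p∣≡2⇒p≡⁅x⁆∪⁅y⁆ (trans (sym balanced) ∣L∣≡2) yi∈R yj∈R yi≢yj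
      where
      ∣L∣≡2 : ∣ L ∣ ≡ 2
      ∣L∣≡2 = trans (sym hits-i) (cong₂ _+_ (∈⇒χ≡1 xi∈L) (∈⇒χ≡1 yi∈R))

    empty-split⇒full : x i ∉ L → y i ∉ R → ∀ l → l ∈ B
    empty-split⇒full xi∉L yi∉R l = Equivalence.from (realizes l)
      (trans (cong₂ _+_ (∣p∣≡0⇒χ≡0 {p = L} (x l) ∣L∣≡0)
                        (∣p∣≡0⇒χ≡0 {p = R} (y l) (trans (sym balanced) ∣L∣≡0)))
             (sym ∣L∣≡0))
      where
      ∣L∣≡0 : ∣ L ∣ ≡ 0
      ∣L∣≡0 = trans (sym hits-i) (cong₂ _+_ (∉⇒χ≡0 xi∉L) (∉⇒χ≡0 yi∉R))

module _ {n m} {x y : Fin n → Fin m} {i j} (xi≢xj : x i ≢ x j) (yi≢yj : y i ≢ y j) where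

  shape : Fin 3 → Subset m × Subset m
  shape 0F = ⁅ x i ⁆ , ⁅ y j ⁆
  shape 1F = ⁅ x j ⁆ , ⁅ y i ⁆
  shape 2F = ⁅ x i ⁆ ∪ ⁅ x j ⁆ , ⁅ y i ⁆ ∪ ⁅ y j ⁆

  realizer-shape : ∀ {B l} (r : Realizer x y B) → i ∈ B → j ∈ B → l ∉ B →
                   ∃ λ μ → (Realizer.L r , Realizer.R r) ≡ shape μ
  realizer-shape {l = l} r i∈B j∈B l∉B with x i ∈? Realizer.L r | y i ∈? Realizer.R r
  ... | yes xi∈L | no  yi∉R = 0F , uncurry (cong₂ _,_) (single-shape r i∈B j∈B xi≢xj xi∈L yi∉R)
  ... | no  xi∉L | yes yi∈R =
    1F , uncurry (flip (cong₂ _,_)) (single-shape (flip-realizer r) i∈B j∈B yi≢yj yi∈R xi∉L)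
  ... | yes xi∈L | yes yi∈R = 2F , uncurry (cong₂ _,_) (double-shape r i∈B j∈B xi≢xj yi≢yj xi∈L yi∈R)
  ... | no  xi∉L | no  yi∉R = ⊥-elim (l∉B (empty-split⇒full r i∈B j∈B xi∉L yi∉R l))

module _ {n m} {x y : Fin n → Fin m} (sh : SwapsShattered x y) {i j} (l : Fin 3 → Fin n)
         (l-injective : Injective _≡_ _≡_ l) (l≢i : ∀ k → l k ≢ i) (l≢j : ∀ k → l k ≢ j)
         (xi≢xj : x i ≢ x j) (yi≢yj : y i ≢ y j) where

  private
    pair : Subset n
    pair = ⁅ i ⁆ ∪ ⁅ j ⁆

    B : Fin 4 → Subset n
    B 0F      = pair
    B (suc k) = ⁅ l k ⁆ ∪ pair

    pair⊆B : ∀ a → pair ⊆ B a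
    pair⊆B 0F      = id
    pair⊆B (suc k) = q⊆p∪q ⁅ l k ⁆ pair

    l∉pair : ∀ k → l k ∉ pair
    l∉pair k = x∉⁅y⁆∪q (l≢i k) (x≢y⇒x∉⁅y⁆ (l≢j k))

    l∉B : ∀ {a : Fin 4} {k} → a ≢ suc k → l k ∉ B a
    l∉B {0F}    _   = l∉pair _
    l∉B {suc _} a≢b = x∉⁅y⁆∪q (a≢b ∘ cong suc ∘ sym ∘ l-injective) (l∉pair _)

    other : Fin 4 → Fin 3
    other 0F      = 0F
    other (suc k) = punchIn k 0F

    other≢ : ∀ (a : Fin 4) → a ≢ suc (other a)
    other≢ (suc k) eq = punchInᵢ≢i k 0F (sym (suc-injective eq))

    split : Fin 4 → Subset m × Subset m
    split a = Realizer.L (sh (B a)) , Realizer.R (sh (B a))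

    shaped : ∀ a → ∃ λ μ → split a ≡ shape xi≢xj yi≢yj μ
    shaped a = realizer-shape xi≢xj yi≢yj (sh (B a)) (pair⊆B a (x∈p∪q⁺ (inj₁ (x∈⁅x⁆ i))))
                              (pair⊆B a (x∈p∪q⁺ (inj₂ (x∈⁅x⁆ j)))) (l∉B (other≢ a))

  apart-swaps-unshattered : ⊥
  apart-swaps-unshattered with pigeonhole (n<1+n 3) (proj₁ ∘ shaped)
  ... | a , suc k , a<b , same-shape =
    l∉B (<⇒≢ a<b) (same-split⇒⊆ (sh (B (suc k))) (sh (B a))
                                (cong proj₁ same-split) (cong proj₂ same-split)
                                (x∈p∪q⁺ (inj₁ (x∈⁅x⁆ (l k)))))
    where
    same-split : split (suc k) ≡ split a
    same-split = trans (proj₂ (shaped (suc k)))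
                       (trans (cong (shape xi≢xj yi≢yj) (sym same-shape)) (sym (proj₂ (shaped a))))

module _ {n} {i j : Fin (suc (suc n))} (i≢j : i ≢ j) where

  avoiding : Fin n → Fin (suc (suc n))
  avoiding k = punchIn i (punchIn (punchOut i≢j) k)

  avoiding-injective : Injective _≡_ _≡_ avoiding
  avoiding-injective = punchIn-injective _ _ _ ∘ punchIn-injective i _ _

  avoiding≢i : ∀ k → avoiding k ≢ i
  avoiding≢i k = punchInᵢ≢i i _

  avoiding≢j : ∀ k → avoiding k ≢ j
  avoiding≢j k eq =
    punchInᵢ≢i (punchOut i≢j) k (punchIn-injective i _ _ (trans eq (sym (punchIn-punchOut i≢j))))

shattered⇒swaps-meet : ∀ {r m} {x y : Fin (5 + r) → Fin m} → SwapsShattered x y →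
                       ∀ {i j} → i ≢ j → x i ≡ x j ⊎ y i ≡ y j
shattered⇒swaps-meet {r} {x = x} {y} sh {i} {j} i≢j with x i ≟ x j | y i ≟ y j
... | yes xi≡xj | _         = inj₁ xi≡xj
... | no  _     | yes yi≡yj = inj₂ yi≡yj
... | no  xi≢xj | no  yi≢yj = ⊥-elim (apart-swaps-unshattered sh (avoiding i≢j ∘ (_↑ˡ r))
  (↑ˡ-injective r _ _ ∘ avoiding-injective i≢j) (avoiding≢i i≢j ∘ (_↑ˡ r)) (avoiding≢j i≢j ∘ (_↑ˡ r))
  xi≢xj yi≢yj)

module _ {I X Y : Set} {x : I → X} {y : I → Y} (_≟ˣ_ : DecidableEquality X)
         (meet : ∀ {i j} → i ≢ j → x i ≡ x j ⊎ y i ≡ y j)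
         (injective : ∀ {i j} → x i ≡ x j → y i ≡ y j → i ≡ j) where

  common-first⇒constant : ∀ {i₀ i₁} → i₀ ≢ i₁ → x i₀ ≡ x i₁ → ∀ j → x j ≡ x i₀
  common-first⇒constant {i₀} {i₁} i₀≢i₁ xi₀≡xi₁ j with x j ≟ˣ x i₀
  ... | yes xj≡xi₀ = xj≡xi₀
  ... | no  xj≢xi₀ with meet i₀≢j | meet i₁≢j
    where
    i₀≢j : i₀ ≢ j
    i₀≢j refl = xj≢xi₀ refl
    i₁≢j : i₁ ≢ j
    i₁≢j refl = xj≢xi₀ (sym xi₀≡xi₁)
  ...   | inj₁ xi₀≡xj | _           = ⊥-elim (xj≢xi₀ (sym xi₀≡xj))
  ...   | inj₂ _      | inj₁ xi₁≡xj = ⊥-elim (xj≢xi₀ (sym (trans xi₀≡xi₁ xi₁≡xj)))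
  ...   | inj₂ yi₀≡yj | inj₂ yi₁≡yj = ⊥-elim (i₀≢i₁ (injective xi₀≡xi₁ (trans yi₀≡yj (sym yi₁≡yj))))

pairwise-meeting⇒star : ∀ {I X Y : Set} {x : I → X} {y : I → Y} →
                        DecidableEquality X → DecidableEquality Y →
                        (∀ {i j} → i ≢ j → x i ≡ x j ⊎ y i ≡ y j) →
                        (∀ {i j} → x i ≡ x j → y i ≡ y j → i ≡ j) →
                        ∀ {i₀ i₁} → i₀ ≢ i₁ → (∀ j → x j ≡ x i₀) ⊎ (∀ j → y j ≡ y i₀)
pairwise-meeting⇒star _≟ˣ_ _≟ʸ_ meet injective i₀≢i₁ with meet i₀≢i₁
... | inj₁ xi₀≡xi₁ = inj₁ (common-first⇒constant _≟ˣ_ meet injective i₀≢i₁ xi₀≡xi₁)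
... | inj₂ yi₀≡yi₁ = inj₂ (common-first⇒constant _≟ʸ_ (Sum.swap ∘ meet) (flip injective) i₀≢i₁ yi₀≡yi₁)

module _ {r m} {x y : Fin (5 + r) → Fin m} {c} (x≡c : ∀ i → x i ≡ c) (sh : SwapsShattered x y) where

  private
    B : Subset (5 + r)
    B = true ∷ true ∷ true ∷ ∅

    open Realizer (sh B)

    b : ℕ
    b = χ L c

    realizes-c : ∀ t → t ∈ B ⇔ (b + χ R (y t) ≡ ∣ L ∣)
    realizes-c t = subst (λ a → t ∈ B ⇔ (χ L a + χ R (y t) ≡ ∣ L ∣)) (x≡c t) (realizes t)

    hits : ∀ {t} → t ∈ B → b + χ R (y t) ≡ ∣ L ∣
    hits = Equivalence.to (realizes-c _)

    y-injective : ∀ {s t} → y s ≡ y t → s ≡ t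
    y-injective = shattered⇒swaps-injective sh (trans (x≡c _) (sym (x≡c _)))

    beyond-2∉B : ∀ t → suc (suc (suc t)) ∉ B
    beyond-2∉B t = ∉⊥ ∘ drop-there ∘ drop-there ∘ drop-there

    ∣R∣≤1+χ₀ : ∣ R ∣ ≤ 1 + χ R (y 0F)
    ∣R∣≤1+χ₀ = subst (_≤ 1 + χ R (y 0F)) (trans (hits here) balanced) (+-monoˡ-≤ _ (χ≤1 L c))

  constant-first-unshattered : ⊥
  constant-first-unshattered with y 0F ∈? R
  ... | yes y₀∈R =
    1+n≰n (≤-trans (distinct-∈⇒3≤∣p∣ (in-R here) (in-R (there here)) (in-R (there (there here)))
                                     ((λ ()) ∘ y-injective) ((λ ()) ∘ y-injective) ((λ ()) ∘ y-injective))
                   (subst (λ χ₀ → ∣ R ∣ ≤ 1 + χ₀) (∈⇒χ≡1 y₀∈R) ∣R∣≤1+χ₀))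
    where
    in-R : ∀ {t} → t ∈ B → y t ∈ R
    in-R t∈B = χ≡1⇒∈ (trans (+-cancelˡ-≡ b _ _ (trans (hits t∈B) (sym (hits here)))) (∈⇒χ≡1 y₀∈R))
  ... | no  y₀∉R =
    1+n≰n (≤-trans (distinct-∈⇒2≤∣p∣ (in-R (beyond-2∉B 0F)) (in-R (beyond-2∉B 1F)) ((λ ()) ∘ y-injective))
                   (subst (λ χ₀ → ∣ R ∣ ≤ 1 + χ₀) (∉⇒χ≡0 y₀∉R) ∣R∣≤1+χ₀))
    where
    in-R : ∀ {t} → t ∉ B → y t ∈ R
    in-R {t} t∉B with y t ∈? R
    ... | yes yt∈R = yt∈R
    ... | no  yt∉R = ⊥-elim (t∉B (Equivalence.from (realizes-c t)
                       (trans (cong (b +_) (trans (∉⇒χ≡0 yt∉R) (sym (∉⇒χ≡0 y₀∉R)))) (hits here))))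

five-swaps-unshattered : ∀ {r m} {x y : Fin (5 + r) → Fin m} → ¬ SwapsShattered x y
five-swaps-unshattered sh
  with pairwise-meeting⇒star _≟_ _≟_ (shattered⇒swaps-meet sh) (shattered⇒swaps-injective sh)
                             {0F} {1F} (λ ())
... | inj₁ x-constant = constant-first-unshattered x-constant sh
... | inj₂ y-constant = constant-first-unshattered y-constant (flip-shattered sh)

mainTheorem1 : (m k : ℕ) → k ≤ m → VCdimEdge≤ m k 4
mainTheorem1 m k _ n A _ shattered with n ≤? 4
... | yes n≤4 = n≤4
... | no  n≰4 with m≤n⇒∃[o]m+o≡n (≰⇒> n≰4)
...   | r , refl =
  let _ , _ , swaps-shattered = shattered⇒swaps-shattered {A = A} shattered in
  ⊥-elim (five-swaps-unshattered swaps-shattered)
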